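{- Let $G$ be a graph that has no isolated vertex, no isolated edge (two adjacent vertices both of degree 1), and no pendant triangle (three pairwise adjacent vertices $u,v,w$ with $\deg(u)=\deg(w)=2$). Let $(D,A,C)$ be its Gallai–Edmonds decomposition and let $S$ be the vertex set of a connected component of $G[D]$ such that $G[S]$ is a triangle star with at least two pendant triangles. Then there exist two nonadjacent vertices $u, v \in S$ such that $u$ has a neighbor $u' \in A$ and $v$ has a neighbor $v' \in A$ (possibly $u' = v'$).
   Context: All graphs are finite, simple and undirected. The Gallai–Edmonds decomposition of $G$ is the partition of $V(G)$ into $D = \{v : \text{some maximum matching of } G \text{ misses } v\}$, $A = N(D)$ (vertices outside $D$ adjacent to $D$), and $C = V(G) \setminus (A \cup D)$. Adding a pendant triangle to a vertex $s$ means adding two new vertices $x, y$ and the edges $xy, xs, ys$. A triangle star is a graph obtained from a triangle by adding any number of pendant triangles to one of its vertices; its pendant triangles are the triangles at the center other than the original one counted appropriately (a triangle star with $t$ pendant triangles consists of $t+1$ triangles sharing exactly one common vertex). -}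

module Defs where

open import Data.Nat using (ℕ; zero; suc; _+_; _≤_)
open import Data.Fin using (Fin)
open import Data.Bool using (Bool; true; false; if_then_else_)
open import Data.Maybe using (Maybe; just; nothing; is-just)
open import Data.List using (List; map; allFin)
open import Data.Nat.ListAction using (sum)
open import Data.Product using (Σ; ∃; _×_; _,_)
open import Data.Unit using (⊤)
open import Data.Empty using (⊥)
open import Relation.Nullary using (¬_)
open import Relation.Binary.PropositionalEquality using (_≡_; _≢_)
open import Function.Bundles using (_⇔_)

record Graph (n : ℕ) : Set where
  field
    adj    : Fin n → Fin n → Bool
    sym    : ∀ u v → adj u v ≡ adj v u
    irrefl : ∀ v → adj v v ≡ false

open Graph public

Adj : ∀ {n} → Graph n → Fin n → Fin n → Set
Adj G u v = adj G u v ≡ true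

countB : ∀ {n} → (Fin n → Bool) → ℕ
countB {n} p = sum (map (λ w → if p w then 1 else 0) (allFin n))

degree : ∀ {n} → Graph n → Fin n → ℕ
degree G v = countB (adj G v)

record Matching {n : ℕ} (G : Graph n) : Set where
  field
    mate     : Fin n → Maybe (Fin n)
    mate-adj : ∀ u v → mate u ≡ just v → Adj G u v
    mate-sym : ∀ u v → mate u ≡ just v → mate v ≡ just u

open Matching public

-- number of vertices covered by the matching (= twice its number of edges)
covered : ∀ {n} {G : Graph n} → Matching G → ℕ
covered M = countB (λ v → is-just (mate M v))

IsMaximumMatching : ∀ {n} (G : Graph n) → Matching G → Set
IsMaximumMatching G M = ∀ (M' : Matching G) → covered M' ≤ covered M

InD : ∀ {n} → Graph n → Fin n → Set
InD G v = Σ (Matching G) λ M → IsMaximumMatching G M × mate M v ≡ nothing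

InA : ∀ {n} → Graph n → Fin n → Set
InA G v = ¬ InD G v × ∃ λ w → InD G w × Adj G v w

InC : ∀ {n} → Graph n → Fin n → Set
InC G v = ¬ InD G v × ¬ InA G v

data ReachIn {n : ℕ} (G : Graph n) (P : Fin n → Set) : Fin n → Fin n → Set where
  here : ∀ {u} → P u → ReachIn G P u u
  step : ∀ {u v w} → P u → Adj G u v → ReachIn G P v w → ReachIn G P u w

IsComponentOfD : ∀ {n} → Graph n → (Fin n → Set) → Set
IsComponentOfD G S =
  (∃ λ s → S s) ×
  (∀ v → S v → InD G v) ×
  (∀ u v → S u → S v → ReachIn G S u v) ×
  (∀ u v → S u → InD G v → Adj G u v → S v)

-- The triangle star with k triangles sharing one vertex (i.e. k - 1 pendant
-- triangles): vertex 'nothing' is the centre, vertices 'just (i , b)' for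
-- i : Fin k, b : Bool are the two other vertices of the i-th triangle.
TSVertex : ℕ → Set
TSVertex k = Maybe (Fin k × Bool)

TSAdj : ∀ {k} → TSVertex k → TSVertex k → Set
TSAdj nothing  nothing  = ⊥
TSAdj nothing  (just _) = ⊤
TSAdj (just _) nothing  = ⊤
TSAdj (just (i , b)) (just (j , c)) = i ≡ j × b ≢ c

InducedIsoTriangleStar : ∀ {n} → Graph n → (Fin n → Set) → ℕ → Set
InducedIsoTriangleStar {n} G S k =
  Σ (TSVertex k → Fin n) λ f →
    (∀ a b → f a ≡ f b → a ≡ b) ×
    (∀ a → S (f a)) ×
    (∀ v → S v → ∃ λ a → f a ≡ v) ×
    (∀ a b → Adj G (f a) (f b) ⇔ TSAdj a b)

IsTriangleStarAtLeast2Pendant : ∀ {n} → Graph n → (Fin n → Set) → Set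
IsTriangleStarAtLeast2Pendant G S =
  ∃ λ t → 2 ≤ t × InducedIsoTriangleStar G S (suc t)

NoIsolatedVertex : ∀ {n} → Graph n → Set
NoIsolatedVertex G = ∀ v → 1 ≤ degree G v

NoIsolatedEdge : ∀ {n} → Graph n → Set
NoIsolatedEdge G = ∀ u v → Adj G u v → ¬ (degree G u ≡ 1 × degree G v ≡ 1)

NoPendantTriangle : ∀ {n} → Graph n → Set
NoPendantTriangle G = ∀ u v w → Adj G u v → Adj G v w → Adj G u w →
  ¬ (degree G u ≡ 2 × degree G w ≡ 2)

-- An outer vertex x of a triangle of the star has exactly two neighbours inside S, the centre
-- and its partner. If x has a third neighbour w, then w lies outside S, hence outside D
-- because S is a component of G[D], and so w ∈ A = N(D). As there are no pendant
-- triangles, the two outer vertices of a triangle cannot both have degree 2, so every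
-- triangle has an outer vertex with a neighbour in A. Outer vertices of different
-- triangles are nonadjacent, so two triangles of the star already give u and v.
module Submission where

open import Defs hiding (sym)
open import Data.Bool using (Bool; true; false; if_then_else_; _∨_; _∧_; not)
open import Data.Bool.Properties using (not-¬; ¬-not) renaming (_≟_ to _≟ᵇ_)
open import Data.Empty using (⊥-elim)
open import Data.Fin using (Fin; zero; suc; _≟_)
open import Data.Fin.Properties using (any?; 0≢1+n)
open import Data.List using (allFin; tabulate)
open import Data.List.Properties using (map-cong; map-tabulate)
open import Data.Maybe using (nothing; just)
open import Data.Nat using (ℕ; suc; _+_; s≤s; z≤n)
open import Data.Nat.ListAction using (sum)
open import Data.Nat.Properties using (+-commutativeSemigroup)
open import Algebra.Properties.CommutativeSemigroup +-commutativeSemigroup using (interchange)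
open import Data.Product using (∃; _×_; _,_; proj₁; proj₂)
open import Data.Sum using (_⊎_; inj₁; inj₂; [_,_]′)
open import Data.Unit using (tt)
open import Function using (_∘_; id)
open import Function.Bundles using (Equivalence; _⇔_)
open import Relation.Binary.PropositionalEquality
  using (_≡_; _≢_; refl; sym; trans; cong; cong₂; module ≡-Reasoning)
open import Relation.Nullary using (¬_; yes; no; does; ¬?; _×-dec_)
open import Relation.Nullary.Decidable using (dec-false)

indicator : Bool → ℕ
indicator b = if b then 1 else 0

countB≡sum-tabulate : ∀ {n} (p : Fin n → Bool) → countB p ≡ sum (tabulate (indicator ∘ p))
countB≡sum-tabulate {n} p = cong sum (map-tabulate id (indicator ∘ p))

countB-suc : ∀ {n} (p : Fin (suc n) → Bool) →
  countB p ≡ indicator (p zero) + countB (p ∘ suc)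
countB-suc p = begin
  countB p
    ≡⟨ countB≡sum-tabulate p ⟩
  indicator (p zero) + sum (tabulate (indicator ∘ p ∘ suc))
    ≡⟨ cong (indicator (p zero) +_) (sym (countB≡sum-tabulate (p ∘ suc))) ⟩
  indicator (p zero) + countB (p ∘ suc)
    ∎
  where open ≡-Reasoning

countB-cong : ∀ {n} {p q : Fin n → Bool} → (∀ w → p w ≡ q w) → countB p ≡ countB q
countB-cong {n} p≗q = cong sum (map-cong (cong indicator ∘ p≗q) (allFin n))

countB-false : ∀ n → countB {n} (λ _ → false) ≡ 0
countB-false 0       = refl
countB-false (suc n) = trans (countB-suc {n} (λ _ → false)) (countB-false n)

countB-≟ : ∀ {n} (a : Fin n) → countB (λ w → does (w ≟ a)) ≡ 1
countB-≟ {suc n} zero    = trans (countB-suc {n} (λ w → does (w ≟ zero))) (cong suc (countB-false n))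
countB-≟ {suc n} (suc a) = trans (countB-suc (λ w → does (w ≟ suc a))) (countB-≟ a)

countB-∨ : ∀ {n} (p q : Fin n → Bool) → (∀ w → p w ∧ q w ≡ false) →
  countB (λ w → p w ∨ q w) ≡ countB p + countB q
countB-∨ {0} p q disjoint = refl
countB-∨ {suc n} p q disjoint = begin
  countB (λ w → p w ∨ q w)
    ≡⟨ countB-suc (λ w → p w ∨ q w) ⟩
  indicator (p zero ∨ q zero) + countB (λ w → p (suc w) ∨ q (suc w))
    ≡⟨ cong (_+ countB (λ w → p (suc w) ∨ q (suc w))) (indicator-∨ (p zero) (q zero) (disjoint zero)) ⟩
  (indicator (p zero) + indicator (q zero)) + countB (λ w → p (suc w) ∨ q (suc w))
    ≡⟨ cong (indicator (p zero) + indicator (q zero) +_) (countB-∨ (p ∘ suc) (q ∘ suc) (disjoint ∘ suc)) ⟩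
  (indicator (p zero) + indicator (q zero)) + (countB (p ∘ suc) + countB (q ∘ suc))
    ≡⟨ interchange (indicator (p zero)) (indicator (q zero)) (countB (p ∘ suc)) (countB (q ∘ suc)) ⟩
  (indicator (p zero) + countB (p ∘ suc)) + (indicator (q zero) + countB (q ∘ suc))
    ≡⟨ sym (cong₂ _+_ (countB-suc p) (countB-suc q)) ⟩
  countB p + countB q
    ∎
  where
  open ≡-Reasoning
  indicator-∨ : ∀ x y → x ∧ y ≡ false → indicator (x ∨ y) ≡ indicator x + indicator y
  indicator-∨ true  false _ = refl
  indicator-∨ false y     _ = refl

countB-≡2 : ∀ {n} {p : Fin n → Bool} {a b : Fin n} → a ≢ b → p a ≡ true → p b ≡ true →
  (∀ w → p w ≡ true → w ≡ a ⊎ w ≡ b) → countB p ≡ 2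
countB-≡2 {p = p} {a} {b} a≢b pa pb only-a-b = begin
  countB p
    ≡⟨ countB-cong p≗a∨b ⟩
  countB (λ w → does (w ≟ a) ∨ does (w ≟ b))
    ≡⟨ countB-∨ _ _ disjoint ⟩
  countB (λ w → does (w ≟ a)) + countB (λ w → does (w ≟ b))
    ≡⟨ cong₂ _+_ (countB-≟ a) (countB-≟ b) ⟩
  2
    ∎
  where
  open ≡-Reasoning
  p≗a∨b : ∀ w → p w ≡ does (w ≟ a) ∨ does (w ≟ b)
  p≗a∨b w with w ≟ a | w ≟ b
  ... | yes refl | _        = pa
  ... | no _     | yes refl = pb
  ... | no w≢a   | no w≢b   with p w in pw
  ...   | true  = ⊥-elim ([ w≢a , w≢b ]′ (only-a-b w pw))
  ...   | false = refl
  disjoint : ∀ w → does (w ≟ a) ∧ does (w ≟ b) ≡ false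
  disjoint w with w ≟ a
  ... | yes refl = dec-false (a ≟ b) a≢b
  ... | no _     = refl

degree≡2⊎third-neighbour : ∀ {n} (G : Graph n) {v a b : Fin n} → a ≢ b → Adj G v a → Adj G v b →
  degree G v ≡ 2 ⊎ ∃ λ w → Adj G v w × w ≢ a × w ≢ b
degree≡2⊎third-neighbour G {v} {a} {b} a≢b va vb
  with any? (λ w → (adj G v w ≟ᵇ true) ×-dec ¬? (w ≟ a) ×-dec ¬? (w ≟ b))
... | yes third = inj₂ third
... | no no-third = inj₁ (countB-≡2 a≢b va vb only-a-b)
  where
  only-a-b : ∀ w → Adj G v w → w ≡ a ⊎ w ≡ b
  only-a-b w vw with w ≟ a | w ≟ b
  ... | yes w≡a | _       = inj₁ w≡a
  ... | no _    | yes w≡b = inj₂ w≡b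
  ... | no w≢a  | no w≢b  = ⊥-elim (no-third (w , vw , w≢a , w≢b))

neighbour-outside-component∈A : ∀ {n} (G : Graph n) {S : Fin n → Set} → IsComponentOfD G S →
  ∀ {v w} → S v → Adj G v w → ¬ S w → InA G w
neighbour-outside-component∈A G (_ , S⊆D , _ , closed) {v} {w} v∈S vw w∉S =
  (λ w∈D → w∉S (closed v w v∈S w∈D vw)) , v , S⊆D v v∈S , trans (Graph.sym G w v) vw

module TriangleStar {n k : ℕ} (G : Graph n) (S : Fin n → Set) (iso : InducedIsoTriangleStar G S k) where

  embed : TSVertex k → Fin n
  embed = proj₁ iso

  embed-injective : ∀ a b → embed a ≡ embed b → a ≡ b
  embed-injective = proj₁ (proj₂ iso)

  embed∈S : ∀ a → S (embed a)
  embed∈S = proj₁ (proj₂ (proj₂ iso))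

  embed-onto : ∀ v → S v → ∃ λ a → embed a ≡ v
  embed-onto = proj₁ (proj₂ (proj₂ (proj₂ iso)))

  embed-adj⇔ : ∀ a b → Adj G (embed a) (embed b) ⇔ TSAdj a b
  embed-adj⇔ = proj₂ (proj₂ (proj₂ (proj₂ iso)))

  centre : Fin n
  centre = embed nothing

  outer : Fin k → Bool → Fin n
  outer i b = embed (just (i , b))

  outer-adj-centre : ∀ i b → Adj G (outer i b) centre
  outer-adj-centre i b = Equivalence.from (embed-adj⇔ _ _) tt

  centre-adj-outer : ∀ i b → Adj G centre (outer i b)
  centre-adj-outer i b = Equivalence.from (embed-adj⇔ _ _) tt

  outer-adj-partner : ∀ i b → Adj G (outer i b) (outer i (not b))
  outer-adj-partner i b = Equivalence.from (embed-adj⇔ _ _) (refl , not-¬ refl)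

  centre≢outer : ∀ i b → centre ≢ outer i b
  centre≢outer i b eq with embed-injective _ _ eq
  ... | ()

  outer-injective : ∀ {i j b c} → outer i b ≡ outer j c → i ≡ j × b ≡ c
  outer-injective eq with embed-injective _ _ eq
  ... | refl = refl , refl

  outer-nonadjacent : ∀ {i j} b c → i ≢ j → ¬ Adj G (outer i b) (outer j c)
  outer-nonadjacent b c i≢j adjacent = i≢j (proj₁ (Equivalence.to (embed-adj⇔ _ _) adjacent))

  outer-neighbours-in-S : ∀ i b {w} → S w → Adj G (outer i b) w → w ≡ centre ⊎ w ≡ outer i (not b)
  outer-neighbours-in-S i b w∈S xw with embed-onto _ w∈S
  ... | nothing , refl = inj₁ refl
  ... | just (j , c) , refl with Equivalence.to (embed-adj⇔ _ _) xw
  ...   | refl , b≢c = inj₂ (cong (outer i) (¬-not (b≢c ∘ sym)))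

  outer-degree≡2⊎A-neighbour : IsComponentOfD G S → ∀ i b →
    degree G (outer i b) ≡ 2 ⊎ ∃ λ w → InA G w × Adj G (outer i b) w
  outer-degree≡2⊎A-neighbour component i b
    with degree≡2⊎third-neighbour G (centre≢outer i (not b))
           (outer-adj-centre i b) (outer-adj-partner i b)
  ... | inj₁ degree≡2 = inj₁ degree≡2
  ... | inj₂ (w , xw , w≢centre , w≢partner) =
    inj₂ (w , neighbour-outside-component∈A G component (embed∈S _) xw w∉S , xw)
    where
    w∉S : ¬ S w
    w∉S w∈S = [ w≢centre , w≢partner ]′ (outer-neighbours-in-S i b w∈S xw)

  triangle-has-A-neighbour : NoPendantTriangle G → IsComponentOfD G S → ∀ i →
    ∃ λ b → ∃ λ w → InA G w × Adj G (outer i b) w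
  triangle-has-A-neighbour no-pendant component i
    with outer-degree≡2⊎A-neighbour component i true | outer-degree≡2⊎A-neighbour component i false
  ... | inj₂ A-neighbour | _              = true , A-neighbour
  ... | inj₁ _           | inj₂ A-neighbour = false , A-neighbour
  ... | inj₁ degree≡2    | inj₁ degree'≡2 =
    ⊥-elim (no-pendant (outer i true) centre (outer i false)
      (outer-adj-centre i true) (centre-adj-outer i false)
      (outer-adj-partner i true) (degree≡2 , degree'≡2))

lemma12 : ∀ {n} (G : Graph n) (S : Fin n → Set) →
    NoIsolatedVertex G → NoIsolatedEdge G → NoPendantTriangle G →
    IsComponentOfD G S → IsTriangleStarAtLeast2Pendant G S →
    ∃ λ u → ∃ λ v → S u × S v × u ≢ v × ¬ Adj G u v ×
      (∃ λ u' → InA G u' × Adj G u u') × (∃ λ v' → InA G v' × Adj G v v')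
lemma12 G S _ _ no-pendant component (suc (suc _) , s≤s (s≤s z≤n) , iso) =
  outer zero (proj₁ u-side) , outer (suc zero) (proj₁ v-side) , embed∈S _ , embed∈S _ ,
  (λ eq → 0≢1+n (proj₁ (outer-injective eq))) , outer-nonadjacent _ _ 0≢1+n ,
  proj₂ u-side , proj₂ v-side
  where
  open TriangleStar G S iso
  u-side : ∃ λ b → ∃ λ w → InA G w × Adj G (outer zero b) w
  u-side = triangle-has-A-neighbour no-pendant component zero
  v-side : ∃ λ c → ∃ λ w → InA G w × Adj G (outer (suc zero) c) w
  v-side = triangle-has-A-neighbour no-pendant component (suc zero)
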